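{- If $G$ is a finite simple bipartite graph with minimum degree $\delta(G)\ge 4$, then $\mathrm{Maj}'(G)\le 4$.
   Context: Two distinct edges are adjacent if they share an endpoint. An edge-coloring $c:E\to C$ (not necessarily proper) of a graph $G=(V,E)$ is a strong majority edge-coloring if for every edge $e\in E$ and every color $\alpha\in C$, at most half of the edges adjacent to $e$ have color $\alpha$. The strong majority index $\mathrm{Maj}'(G)$ is the least number of colors in such a coloring. -}

module Defs where

open import Data.Nat using (ℕ; _+_; _*_; _∸_; _≤_)
open import Data.Bool using (Bool; true; false; _∧_; not; T)
open import Data.Fin using (Fin)
open import Data.Fin.Properties using (_≟_)
open import Data.List using (List; length; filterᵇ; allFin)
open import Data.Product using (Σ; _×_)
open import Relation.Nullary.Decidable using (⌊_⌋)
open import Relation.Binary.PropositionalEquality using (_≡_; _≢_)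

record SimpleGraph (n : ℕ) : Set where
  field
    adj   : Fin n → Fin n → Bool
    sym   : ∀ u v → adj u v ≡ adj v u
    irref : ∀ v → adj v v ≡ false
open SimpleGraph public

countᵇ : {n : ℕ} → (Fin n → Bool) → ℕ
countᵇ {n} p = length (filterᵇ p (allFin n))

degree : {n : ℕ} → SimpleGraph n → Fin n → ℕ
degree G u = countᵇ (λ w → adj G u w)

MinDegreeAtLeast : {n : ℕ} → SimpleGraph n → ℕ → Set
MinDegreeAtLeast G d = ∀ v → d ≤ degree G v

Bipartite : {n : ℕ} → SimpleGraph n → Set
Bipartite {n} G = Σ (Fin n → Bool) λ side →
  ∀ u v → T (adj G u v) → side u ≢ side v

-- An edge-colouring with colour set C: an assignment of a colour to each
-- ordered pair, which on edges does not depend on the orientation (so it is a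
-- function on the unordered edges {u,v}); values on non-edges are irrelevant.
EdgeColouring : {n : ℕ} → SimpleGraph n → Set → Set
EdgeColouring {n} G C = Σ (Fin n → Fin n → C) λ c →
  ∀ u v → T (adj G u v) → c u v ≡ c v u

colouredAt : {n k : ℕ} → SimpleGraph n → (Fin n → Fin n → Fin k) →
             Fin n → Fin n → Fin k → ℕ
colouredAt G c u v α =
  countᵇ (λ w → adj G u w ∧ not ⌊ w ≟ v ⌋ ∧ ⌊ c u w ≟ α ⌋)

-- The edges adjacent to the edge e = {u,v} (in a simple graph) are exactly the
-- edges {u,w} with w ≠ v and {v,w} with w ≠ u; these two families are disjoint,
-- and there are (deg u - 1) + (deg v - 1) of them.
IsStrongMajority : {n k : ℕ} → (G : SimpleGraph n) → (Fin n → Fin n → Fin k) → Set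
IsStrongMajority {n} {k} G c = ∀ (u v : Fin n) → T (adj G u v) → ∀ (α : Fin k) →
  2 * (colouredAt G c u v α + colouredAt G c v u α)
    ≤ (degree G u ∸ 1) + (degree G v ∸ 1)

-- Maj'(G) ≤ k : there is a strong majority edge-colouring using colours from a k-element set
-- (a colouring with at most k colours is the same as one with values in Fin k).
MajIndexAtMost : {n : ℕ} → SimpleGraph n → ℕ → Set
MajIndexAtMost G k = Σ (EdgeColouring G (Fin k)) λ cc → IsStrongMajority G (Data.Product.proj₁ cc)

{-# OPTIONS --safe #-}

-- Every finite multigraph, given as a list of edges, can be oriented so that in- and out-degree
-- differ by at most one at every vertex: take an edge ab; if no other edge meets b, orient ab so
-- as to repair the balance at a; otherwise splice ab with another edge bc into ac, orient the
-- shorter list, and expand ac back into a directed path through b.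
-- In a bipartite graph, colouring each edge by whether it points away from a fixed side turns
-- such an orientation into a 2-edge-colouring in which every vertex sees both colours almost
-- equally often. Splitting both colour classes once more gives four colours, each used at most
-- (d + 3)/4 times at a vertex of degree d, and 2⌊(d + 3)/4⌋ ≤ d - 1 as soon as d ≥ 4. So at each
-- end of an edge a colour covers at most half of the other edges there.

module Submission where

open import Data.Bool using (Bool; true; false; _∧_; not; T; if_then_else_)
open import Data.Bool.Properties using (∧-assoc; ∧-comm; ∧-zeroʳ; ∧-identityʳ; not-involutive; T-∧)
open import Data.Empty using (⊥-elim)
open import Data.Fin using (Fin; zero; suc)
open import Data.Fin.Patterns using (0F; 1F; 2F; 3F)
open import Data.Fin.Properties using (_≟_; suc-injective)
open import Data.List using (List; []; _∷_; [_]; _++_; length; filterᵇ; allFin; tabulate; concat)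
open import Data.List.Membership.Propositional using (find)
open import Data.List.Membership.Propositional.Properties using (∈-∃++)
open import Data.List.Properties using (length-++)
open import Data.List.Relation.Binary.Pointwise using (Pointwise; []; _∷_; ++⁺; All-resp-Pointwise)
open import Data.List.Relation.Unary.All using (All; []; _∷_)
open import Data.List.Relation.Unary.All.Properties using (¬Any⇒All¬)
open import Data.List.Relation.Unary.Any using (any?)
open import Data.Nat using (ℕ; zero; suc; _+_; _*_; _∸_; _≤_; _<_; z≤n; s≤s; _≤?_; _<ᵇ_)
open import Data.Nat.Properties
  using ( +-assoc; +-comm; +-suc; +-identityʳ; +-mono-≤; +-monoˡ-≤; +-monoʳ-≤; *-monoʳ-≤; *-distribˡ-+
        ; *-cancelˡ-<; ≤-refl; ≤-trans; ≤-reflexive; m≤n⇒m≤1+n; ≰⇒>; <⇒≤pred; pred[m∸n]≡m∸[1+n]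
        ; *-suc; +-commutativeSemigroup; +-0-commutativeMonoid; module ≤-Reasoning)
open import Algebra.Properties.CommutativeSemigroup +-commutativeSemigroup using (interchange; x∙yz≈y∙xz)
open import Algebra.Properties.CommutativeMonoid.Sum +-0-commutativeMonoid
  using (sum-cong-≗; sum-replicate-zero; ∑-distrib-+; sum-syntax)
open import Data.Product using (Σ; ∃; ∃₂; _×_; _,_; proj₁; proj₂; swap)
open import Data.Sum using (_⊎_; inj₁; inj₂)
import Data.Sum as Sum
open import Function using (_∘_; id; Equivalence)
open import Relation.Binary.Definitions using (DecidableEquality)
open import Relation.Binary.PropositionalEquality
  using (_≡_; _≢_; refl; sym; trans; cong; cong₂; subst; subst₂; module ≡-Reasoning)
open import Relation.Nullary using (¬_; yes; no; does)
open import Relation.Nullary.Decidable using (⌊_⌋; dec-true; dec-false; _⊎-dec_)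
open import Defs hiding (sym)

private variable
  A : Set
  n : ℕ

𝟙 : Bool → ℕ
𝟙 true  = 1
𝟙 false = 0

count : (A → Bool) → List A → ℕ
count p []       = 0
count p (x ∷ xs) = 𝟙 (p x) + count p xs

count-++ : ∀ (p : A → Bool) xs ys → count p (xs ++ ys) ≡ count p xs + count p ys
count-++ p []       ys = refl
count-++ p (x ∷ xs) ys = trans (cong (𝟙 (p x) +_) (count-++ p xs ys)) (sym (+-assoc (𝟙 (p x)) _ _))

count-middle : ∀ (p : A → Bool) xs y ys → count p (xs ++ y ∷ ys) ≡ 𝟙 (p y) + count p (xs ++ ys)
count-middle p xs y ys = begin
  count p (xs ++ y ∷ ys)               ≡⟨ count-++ p xs (y ∷ ys) ⟩
  count p xs + (𝟙 (p y) + count p ys)  ≡⟨ x∙yz≈y∙xz (count p xs) (𝟙 (p y)) (count p ys) ⟩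
  𝟙 (p y) + (count p xs + count p ys)  ≡⟨ cong (𝟙 (p y) +_) (count-++ p xs ys) ⟨
  𝟙 (p y) + count p (xs ++ ys)         ∎
  where open ≡-Reasoning

length-filterᵇ : ∀ (p : A → Bool) xs → length (filterᵇ p xs) ≡ count p xs
length-filterᵇ p []       = refl
length-filterᵇ p (x ∷ xs) with p x
... | true  = cong suc (length-filterᵇ p xs)
... | false = length-filterᵇ p xs

count-tabulate : ∀ (p : A → Bool) (f : Fin n → A) → count p (tabulate f) ≡ ∑[ i < n ] 𝟙 (p (f i))
count-tabulate {n = zero}  p f = refl
count-tabulate {n = suc n} p f = cong (𝟙 (p (f zero)) +_) (count-tabulate p (f ∘ suc))

count-concat-tabulate : ∀ (p : A → Bool) (F : Fin n → List A) →
  count p (concat (tabulate F)) ≡ ∑[ i < n ] count p (F i)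
count-concat-tabulate {n = zero}  p F = refl
count-concat-tabulate {n = suc n} p F =
  trans (count-++ p (F zero) _) (cong (count p (F zero) +_) (count-concat-tabulate p (F ∘ suc)))

∑-mono-≤ : {f g : Fin n → ℕ} → (∀ i → f i ≤ g i) → ∑[ i < n ] f i ≤ ∑[ i < n ] g i
∑-mono-≤ {n = zero}  f≤g = z≤n
∑-mono-≤ {n = suc n} f≤g = +-mono-≤ (f≤g zero) (∑-mono-≤ (f≤g ∘ suc))

∑-single : ∀ (y : Fin n) (f : Fin n → ℕ) → (∀ w → w ≢ y → f w ≡ 0) → ∑[ w < n ] f w ≡ f y
∑-single {n = suc n} zero f f-off = begin
  f zero + ∑[ w < n ] f (suc w)  ≡⟨ cong (f zero +_) (sum-cong-≗ λ w → f-off (suc w) λ ()) ⟩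
  f zero + ∑[ w < n ] 0          ≡⟨ cong (f zero +_) (sum-replicate-zero n) ⟩
  f zero + 0                     ≡⟨ +-identityʳ (f zero) ⟩
  f zero                         ∎
  where open ≡-Reasoning
∑-single {n = suc n} (suc y) f f-off =
  trans (cong (_+ ∑[ w < n ] f (suc w)) (f-off zero λ ()))
        (∑-single y (f ∘ suc) λ w w≢y → f-off (suc w) (w≢y ∘ suc-injective))

NearlyEqual : ℕ → ℕ → Set
NearlyEqual m n = m ≤ suc n × n ≤ suc m

NearlyEqual-+ : ∀ t {m n} → NearlyEqual m n → NearlyEqual (t + m) (t + n)
NearlyEqual-+ t {m} {n} (m≤1+n , n≤1+m) =
  ≤-trans (+-monoʳ-≤ t m≤1+n) (≤-reflexive (+-suc t n)) ,
  ≤-trans (+-monoʳ-≤ t n≤1+m) (≤-reflexive (+-suc t m))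

Pointwise-++⁻ : ∀ {A B : Set} {_∼_ : A → B → Set} xs {ys zs} → Pointwise _∼_ (xs ++ ys) zs →
  ∃₂ λ zs₁ zs₂ → zs ≡ zs₁ ++ zs₂ × Pointwise _∼_ xs zs₁ × Pointwise _∼_ ys zs₂
Pointwise-++⁻ []       ys∼zs = [] , _ , refl , [] , ys∼zs
Pointwise-++⁻ (x ∷ xs) (x∼z ∷ xs++ys∼zs) with Pointwise-++⁻ xs xs++ys∼zs
... | zs₁ , zs₂ , refl , xs∼zs₁ , ys∼zs₂ = _ ∷ zs₁ , zs₂ , refl , x∼z ∷ xs∼zs₁ , ys∼zs₂

length-∷-++ : ∀ (x : A) xs y ys → length (x ∷ xs ++ ys) ≡ length (xs ++ y ∷ ys)
length-∷-++ x xs y ys = begin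
  suc (length (xs ++ ys))          ≡⟨ cong suc (length-++ xs) ⟩
  suc (length xs + length ys)      ≡⟨ +-suc (length xs) (length ys) ⟨
  length xs + length (y ∷ ys)      ≡⟨ length-++ xs ⟨
  length (xs ++ y ∷ ys)            ∎
  where open ≡-Reasoning

module Orientation {V : Set} (_≟_ : DecidableEquality V) where

  outdeg indeg : V → List (V × V) → ℕ
  outdeg x = count λ e → does (proj₁ e ≟ x)
  indeg  x = count λ e → does (proj₂ e ≟ x)

  Balanced : List (V × V) → Set
  Balanced R = ∀ x → NearlyEqual (outdeg x R) (indeg x R)

  SameEdge : V × V → V × V → Set
  SameEdge e e′ = e′ ≡ e ⊎ e′ ≡ swap e

  Reorientation : List (V × V) → List (V × V) → Set
  Reorientation = Pointwise SameEdge

  SameEdge-swap : ∀ {e b c} → SameEdge e (b , c) → SameEdge e (c , b)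
  SameEdge-swap (inj₁ refl) = inj₂ refl
  SameEdge-swap (inj₂ refl) = inj₁ refl

  Balanced-shift : ∀ (t : V → ℕ) R R′ →
    (∀ x → outdeg x R′ ≡ t x + outdeg x R) → (∀ x → indeg x R′ ≡ t x + indeg x R) →
    Balanced R → Balanced R′
  Balanced-shift t R R′ out≡ in≡ bal x rewrite out≡ x | in≡ x = NearlyEqual-+ (t x) (bal x)

  splice : ∀ a b c R₁ R₂ → Balanced ((a , c) ∷ R₁ ++ R₂) → Balanced ((a , b) ∷ R₁ ++ (b , c) ∷ R₂)
  splice a b c R₁ R₂ =
    Balanced-shift (λ x → 𝟙 (does (b ≟ x))) ((a , c) ∷ R₁ ++ R₂) ((a , b) ∷ R₁ ++ (b , c) ∷ R₂)
    (λ x → trans (cong (𝟙 (does (a ≟ x)) +_) (count-middle _ R₁ (b , c) R₂))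
                 (x∙yz≈y∙xz (𝟙 (does (a ≟ x))) (𝟙 (does (b ≟ x))) (outdeg x (R₁ ++ R₂))))
    (λ x → cong (𝟙 (does (b ≟ x)) +_) (count-middle _ R₁ (b , c) R₂))

  splice-reversed : ∀ a b c R₁ R₂ → Balanced ((c , a) ∷ R₁ ++ R₂) → Balanced ((b , a) ∷ R₁ ++ (c , b) ∷ R₂)
  splice-reversed a b c R₁ R₂ =
    Balanced-shift (λ x → 𝟙 (does (b ≟ x))) ((c , a) ∷ R₁ ++ R₂) ((b , a) ∷ R₁ ++ (c , b) ∷ R₂)
    (λ x → cong (𝟙 (does (b ≟ x)) +_) (count-middle _ R₁ (c , b) R₂))
    (λ x → trans (cong (𝟙 (does (a ≟ x)) +_) (count-middle _ R₁ (c , b) R₂))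
                 (x∙yz≈y∙xz (𝟙 (does (a ≟ x))) (𝟙 (does (b ≟ x))) (indeg x (R₁ ++ R₂))))

  attach-pendant : ∀ a b R → Balanced R → outdeg b R ≡ 0 → indeg b R ≡ 0 →
    ∃ λ e → SameEdge (a , b) e × Balanced (e ∷ R)
  attach-pendant a b R bal out-b in-b with outdeg a R ≤? indeg a R
  ... | yes out≤in = (a , b) , inj₁ refl , forward
    where
    forward : Balanced ((a , b) ∷ R)
    forward x with a ≟ x | b ≟ x
    ... | yes refl | yes refl = NearlyEqual-+ 1 (bal x)
    ... | yes refl | no _     = s≤s out≤in , m≤n⇒m≤1+n (proj₂ (bal x))
    ... | no _     | yes refl rewrite out-b | in-b = z≤n , s≤s z≤n
    ... | no _     | no _     = bal x
  ... | no out≰in = (b , a) , inj₂ refl , backward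
    where
    backward : Balanced ((b , a) ∷ R)
    backward x with a ≟ x | b ≟ x
    ... | yes refl | yes refl = NearlyEqual-+ 1 (bal x)
    ... | yes refl | no _     = m≤n⇒m≤1+n (proj₁ (bal x)) , m≤n⇒m≤1+n (≰⇒> out≰in)
    ... | no _     | yes refl rewrite out-b | in-b = s≤s z≤n , z≤n
    ... | no _     | no _     = bal x

  Incident : V → V × V → Set
  Incident b e = proj₁ e ≡ b ⊎ proj₂ e ≡ b

  incident⇒SameEdge : ∀ {b e} → Incident b e → ∃ λ c → SameEdge e (b , c)
  incident⇒SameEdge {e = _ , c} (inj₁ refl) = c , inj₁ refl
  incident⇒SameEdge {e = c , _} (inj₂ refl) = c , inj₂ refl

  ¬Incident-resp-SameEdge : ∀ {b e e′} → SameEdge e e′ → ¬ Incident b e → ¬ Incident b e′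
  ¬Incident-resp-SameEdge (inj₁ refl) b∉e = b∉e
  ¬Incident-resp-SameEdge (inj₂ refl) b∉e = b∉e ∘ Sum.swap

  isolated : ∀ {b} R → All (¬_ ∘ Incident b) R → outdeg b R ≡ 0 × indeg b R ≡ 0
  isolated []      []          = refl , refl
  isolated {b} (e ∷ R) (b∉e ∷ b∉R)
    rewrite dec-false (proj₁ e ≟ b) (b∉e ∘ inj₁) | dec-false (proj₂ e ≟ b) (b∉e ∘ inj₂) = isolated R b∉R

  unsplice : ∀ {a b c e} pre post → SameEdge e (b , c) →
    (∃ λ R → Reorientation ((a , c) ∷ pre ++ post) R × Balanced R) →
    ∃ λ R → Reorientation ((a , b) ∷ pre ++ e ∷ post) R × Balanced R
  unsplice pre post e↝bc (_ ∷ R , inj₁ refl ∷ pre++post↝R , balanced) with Pointwise-++⁻ pre pre++post↝R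
  ... | R₁ , R₂ , refl , pre↝R₁ , post↝R₂ =
    _ , inj₁ refl ∷ ++⁺ pre↝R₁ (e↝bc ∷ post↝R₂) , splice _ _ _ R₁ R₂ balanced
  unsplice pre post e↝bc (_ ∷ R , inj₂ refl ∷ pre++post↝R , balanced) with Pointwise-++⁻ pre pre++post↝R
  ... | R₁ , R₂ , refl , pre↝R₁ , post↝R₂ =
    _ , inj₂ refl ∷ ++⁺ pre↝R₁ (SameEdge-swap e↝bc ∷ post↝R₂) , splice-reversed _ _ _ R₁ R₂ balanced

  balance : ∀ k L → length L ≤ k → ∃ λ R → Reorientation L R × Balanced R
  balance _ [] _ = [] , [] , λ _ → z≤n , z≤n
  balance (suc k) ((a , b) ∷ rest) (s≤s |rest|≤k)
    with any? (λ e → (proj₁ e ≟ b) ⊎-dec (proj₂ e ≟ b)) rest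
  ... | no b∉rest =
    let R , rest↝R , balanced-R = balance k rest |rest|≤k
        out-b , in-b = isolated R
          (All-resp-Pointwise ¬Incident-resp-SameEdge rest↝R (¬Any⇒All¬ rest b∉rest))
        e , ab↝e , balanced = attach-pendant a b R balanced-R out-b in-b
    in e ∷ R , ab↝e ∷ rest↝R , balanced
  ... | yes b∈rest with find b∈rest
  ...   | e , e∈rest , b∼e with ∈-∃++ e∈rest | incident⇒SameEdge b∼e
  ...     | pre , post , refl | c , e↝bc = unsplice pre post e↝bc
    (balance k ((a , c) ∷ pre ++ post) (≤-trans (≤-reflexive (length-∷-++ (a , c) pre e post)) |rest|≤k))

  balanced-reorientation : ∀ L → ∃ λ R → Reorientation L R × Balanced R
  balanced-reorientation L = balance (length L) L ≤-refl

  arc? : V × V → V × V → Bool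
  arc? (x , w) e = does (proj₁ e ≟ x) ∧ does (proj₂ e ≟ w)

  multiplicity : V × V → List (V × V) → ℕ
  multiplicity xw = count (arc? xw)

  edgeMultiplicity : V → V → List (V × V) → ℕ
  edgeMultiplicity x w L = multiplicity (x , w) L + multiplicity (w , x) L

  arc?-swap : ∀ x w e → arc? (x , w) (swap e) ≡ arc? (w , x) e
  arc?-swap x w (e₁ , e₂) = ∧-comm (does (e₂ ≟ x)) (does (e₁ ≟ w))

  SameEdge-arcs : ∀ x w {e e′} → SameEdge e e′ →
    𝟙 (arc? (x , w) e′) + 𝟙 (arc? (w , x) e′) ≡ 𝟙 (arc? (x , w) e) + 𝟙 (arc? (w , x) e)
  SameEdge-arcs x w     (inj₁ refl) = refl
  SameEdge-arcs x w {e} (inj₂ refl) =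
    trans (cong₂ (λ s t → 𝟙 s + 𝟙 t) (arc?-swap x w e) (arc?-swap w x e)) (+-comm (𝟙 (arc? (w , x) e)) _)

  edgeMultiplicity-reorientation : ∀ x w {L R} → Reorientation L R →
    edgeMultiplicity x w R ≡ edgeMultiplicity x w L
  edgeMultiplicity-reorientation x w [] = refl
  edgeMultiplicity-reorientation x w (_∷_ {x = e} {y = e′} {xs = L} {ys = R} e↝e′ L↝R) = begin
    (𝟙 (arc? (x , w) e′) + multiplicity (x , w) R) + (𝟙 (arc? (w , x) e′) + multiplicity (w , x) R)
      ≡⟨ interchange (𝟙 (arc? (x , w) e′)) _ _ _ ⟩
    (𝟙 (arc? (x , w) e′) + 𝟙 (arc? (w , x) e′)) + edgeMultiplicity x w R
      ≡⟨ cong₂ _+_ (SameEdge-arcs x w e↝e′) (edgeMultiplicity-reorientation x w L↝R) ⟩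
    (𝟙 (arc? (x , w) e) + 𝟙 (arc? (w , x) e)) + edgeMultiplicity x w L
      ≡⟨ interchange (𝟙 (arc? (x , w) e)) _ _ _ ⟨
    (𝟙 (arc? (x , w) e) + multiplicity (x , w) L) + (𝟙 (arc? (w , x) e) + multiplicity (w , x) L) ∎
    where open ≡-Reasoning

module _ {n : ℕ} where
  open Orientation (_≟_ {n})

  ∑-arc-out : ∀ x e → ∑[ w < n ] 𝟙 (arc? (x , w) e) ≡ 𝟙 (does (proj₁ e ≟ x))
  ∑-arc-out x (e₁ , e₂) = trans (∑-single e₂ _ off) on
    where
    off : ∀ w → w ≢ e₂ → 𝟙 (arc? (x , w) (e₁ , e₂)) ≡ 0
    off w w≢e₂ rewrite dec-false (e₂ ≟ w) (w≢e₂ ∘ sym) = cong 𝟙 (∧-zeroʳ _)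
    on : 𝟙 (arc? (x , e₂) (e₁ , e₂)) ≡ 𝟙 (does (e₁ ≟ x))
    on rewrite dec-true (e₂ ≟ e₂) refl = cong 𝟙 (∧-identityʳ _)

  ∑-arc-in : ∀ x e → ∑[ w < n ] 𝟙 (arc? (w , x) e) ≡ 𝟙 (does (proj₂ e ≟ x))
  ∑-arc-in x (e₁ , e₂) = trans (∑-single e₁ _ off) on
    where
    off : ∀ w → w ≢ e₁ → 𝟙 (arc? (w , x) (e₁ , e₂)) ≡ 0
    off w w≢e₁ rewrite dec-false (e₁ ≟ w) (w≢e₁ ∘ sym) = refl
    on : 𝟙 (arc? (e₁ , x) (e₁ , e₂)) ≡ 𝟙 (does (e₂ ≟ x))
    on rewrite dec-true (e₁ ≟ e₁) refl = refl

  ∑-multiplicity-out : ∀ x R → ∑[ w < n ] multiplicity (x , w) R ≡ outdeg x R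
  ∑-multiplicity-out x []      = sum-replicate-zero n
  ∑-multiplicity-out x (e ∷ R) =
    trans (∑-distrib-+ (λ w → 𝟙 (arc? (x , w) e)) _) (cong₂ _+_ (∑-arc-out x e) (∑-multiplicity-out x R))

  ∑-multiplicity-in : ∀ x R → ∑[ w < n ] multiplicity (w , x) R ≡ indeg x R
  ∑-multiplicity-in x []      = sum-replicate-zero n
  ∑-multiplicity-in x (e ∷ R) =
    trans (∑-distrib-+ (λ w → 𝟙 (arc? (w , x) e)) _) (cong₂ _+_ (∑-arc-in x e) (∑-multiplicity-in x R))

  pairsWhere : (Fin n → Fin n → Bool) → List (Fin n × Fin n)
  pairsWhere q = concat (tabulate λ u → concat (tabulate λ v → if q u v then [ (u , v) ] else []))

  multiplicity-pairsWhere : ∀ q x w → multiplicity (x , w) (pairsWhere q) ≡ 𝟙 (q x w)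
  multiplicity-pairsWhere q x w = begin
    multiplicity (x , w) (pairsWhere q)          ≡⟨ count-concat-tabulate _ row ⟩
    ∑[ u < n ] multiplicity (x , w) (row u)      ≡⟨ ∑-single x _ off-row ⟩
    multiplicity (x , w) (row x)                 ≡⟨ count-concat-tabulate _ (cell x) ⟩
    ∑[ v < n ] multiplicity (x , w) (cell x v)   ≡⟨ ∑-single w _ (λ v v≢w → cell-off x v λ where refl → v≢w refl) ⟩
    multiplicity (x , w) (cell x w)              ≡⟨ cell-on ⟩
    𝟙 (q x w)                                    ∎
    where
    open ≡-Reasoning
    cell : Fin n → Fin n → List (Fin n × Fin n)
    cell u v = if q u v then [ (u , v) ] else []
    row : Fin n → List (Fin n × Fin n)
    row u = concat (tabulate (cell u))
    arc-off : ∀ u v → (u , v) ≢ (x , w) → arc? (x , w) (u , v) ≡ false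
    arc-off u v uv≢xw with u ≟ x | v ≟ w
    ... | yes refl | yes refl = ⊥-elim (uv≢xw refl)
    ... | yes _    | no _     = refl
    ... | no _     | _        = refl
    cell-off : ∀ u v → (u , v) ≢ (x , w) → multiplicity (x , w) (cell u v) ≡ 0
    cell-off u v uv≢xw with q u v
    ... | true  rewrite arc-off u v uv≢xw = refl
    ... | false = refl
    off-row : ∀ u → u ≢ x → multiplicity (x , w) (row u) ≡ 0
    off-row u u≢x = begin
      multiplicity (x , w) (row u)              ≡⟨ count-concat-tabulate _ (cell u) ⟩
      ∑[ v < n ] multiplicity (x , w) (cell u v) ≡⟨ sum-cong-≗ (λ v → cell-off u v λ where refl → u≢x refl) ⟩
      ∑[ v < n ] 0                               ≡⟨ sum-replicate-zero n ⟩
      0                                          ∎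
    cell-on : multiplicity (x , w) (cell x w) ≡ 𝟙 (q x w)
    cell-on with q x w
    ... | false = refl
    ... | true  rewrite dec-true (x ≟ x) refl | dec-true (w ≟ w) refl = refl

countᵇ≡∑ : (p : Fin n → Bool) → countᵇ p ≡ ∑[ w < n ] 𝟙 (p w)
countᵇ≡∑ {n} p = trans (length-filterᵇ p (allFin n)) (count-tabulate p id)

countᵇ-cong : {p q : Fin n → Bool} → (∀ w → p w ≡ q w) → countᵇ p ≡ countᵇ q
countᵇ-cong {p = p} {q} p≗q =
  trans (countᵇ≡∑ p) (trans (sum-cong-≗ (cong 𝟙 ∘ p≗q)) (sym (countᵇ≡∑ q)))

𝟙-split : ∀ b c → 𝟙 b ≡ 𝟙 (b ∧ c) + 𝟙 (b ∧ not c)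
𝟙-split false c     = refl
𝟙-split true  false = refl
𝟙-split true  true  = refl

countᵇ-split : (p r : Fin n → Bool) →
  countᵇ p ≡ countᵇ (λ w → p w ∧ r w) + countᵇ (λ w → p w ∧ not (r w))
countᵇ-split {n} p r = begin
  countᵇ p
    ≡⟨ countᵇ≡∑ p ⟩
  ∑[ w < n ] 𝟙 (p w)
    ≡⟨ sum-cong-≗ (λ w → 𝟙-split (p w) (r w)) ⟩
  ∑[ w < n ] (𝟙 (p w ∧ r w) + 𝟙 (p w ∧ not (r w)))
    ≡⟨ ∑-distrib-+ (λ w → 𝟙 (p w ∧ r w)) _ ⟩
  ∑[ w < n ] 𝟙 (p w ∧ r w) + ∑[ w < n ] 𝟙 (p w ∧ not (r w))
    ≡⟨ cong₂ _+_ (countᵇ≡∑ (λ w → p w ∧ r w)) (countᵇ≡∑ (λ w → p w ∧ not (r w))) ⟨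
  countᵇ (λ w → p w ∧ r w) + countᵇ (λ w → p w ∧ not (r w))
    ∎
  where open ≡-Reasoning

𝟙-mono : ∀ {b c} → (T b → T c) → 𝟙 b ≤ 𝟙 c
𝟙-mono {false}         _   = z≤n
𝟙-mono {true}  {true}  _   = ≤-refl
𝟙-mono {true}  {false} b⇒c = ⊥-elim (b⇒c _)

countᵇ-mono : {p q : Fin n → Bool} → (∀ w → T (p w) → T (q w)) → countᵇ p ≤ countᵇ q
countᵇ-mono {p = p} {q} p⇒q =
  subst₂ _≤_ (sym (countᵇ≡∑ p)) (sym (countᵇ≡∑ q)) (∑-mono-≤ λ w → 𝟙-mono (p⇒q w))

record BalancedSplit (G : SimpleGraph n) : Set where
  field
    colour    : Fin n → Fin n → Bool
    symmetric : ∀ u v → T (adj G u v) → colour u v ≡ colour v u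
    balanced  : ∀ x → NearlyEqual (countᵇ λ w → adj G x w ∧ colour x w)
                                  (countᵇ λ w → adj G x w ∧ not (colour x w))
open BalancedSplit

opposite : {G : SimpleGraph n} → BalancedSplit G → BalancedSplit G
opposite s .colour u v            = not (colour s u v)
opposite s .symmetric u v uv      = cong not (symmetric s u v uv)
opposite {G = G} s .balanced x    =
  subst (NearlyEqual _) (countᵇ-cong λ w → cong (adj G x w ∧_) (sym (not-involutive (colour s x w))))
    (swap (balanced s x))

subgraph : {G : SimpleGraph n} → BalancedSplit G → SimpleGraph n
subgraph {G = G} s .adj u v   = adj G u v ∧ colour s u v
subgraph {G = G} s .irref v   = cong (_∧ colour s v v) (irref G v)
subgraph {G = G} s .SimpleGraph.sym u v with adj G u v in uv
... | false = sym (cong (_∧ colour s v u) (trans (SimpleGraph.sym G v u) uv))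
... | true  rewrite trans (SimpleGraph.sym G v u) uv = symmetric s u v (subst T (sym uv) _)

subgraph-bipartite : {G : SimpleGraph n} (s : BalancedSplit G) → Bipartite G → Bipartite (subgraph s)
subgraph-bipartite {G = G} s (side , proper) =
  side , λ u v uv → proper u v (proj₁ (Equivalence.to T-∧ uv))

-- The colour of an edge seen from an endpoint on side s, which the edge leaves p times and enters
-- q times in an orientation: whether it points away from the side true.
fromTrueSide : Bool → ℕ → ℕ → Bool
fromTrueSide true  p q = 0 <ᵇ p
fromTrueSide false p q = 0 <ᵇ q

fromTrueSide-swap : ∀ {s t} p q → s ≢ t → fromTrueSide s p q ≡ fromTrueSide t q p
fromTrueSide-swap {true}  {true}  p q s≢t = ⊥-elim (s≢t refl)
fromTrueSide-swap {true}  {false} p q s≢t = refl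
fromTrueSide-swap {false} {true}  p q s≢t = refl
fromTrueSide-swap {false} {false} p q s≢t = ⊥-elim (s≢t refl)

𝟙-positive : ∀ e p q → p + q ≡ 𝟙 e → 𝟙 (e ∧ (0 <ᵇ p)) ≡ p × 𝟙 (e ∧ not (0 <ᵇ p)) ≡ q
𝟙-positive false zero          zero          refl = refl , refl
𝟙-positive false zero          (suc q)       ()
𝟙-positive false (suc p)       q             ()
𝟙-positive true  zero          zero          ()
𝟙-positive true  zero          (suc zero)    refl = refl , refl
𝟙-positive true  zero          (suc (suc q)) ()
𝟙-positive true  (suc zero)    zero          refl = refl , refl
𝟙-positive true  (suc zero)    (suc q)       ()
𝟙-positive true  (suc (suc p)) q             ()

countᵇ-positive : (e : Fin n → Bool) (p q : Fin n → ℕ) → (∀ w → p w + q w ≡ 𝟙 (e w)) →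
  countᵇ (λ w → e w ∧ (0 <ᵇ p w)) ≡ ∑[ w < n ] p w × countᵇ (λ w → e w ∧ not (0 <ᵇ p w)) ≡ ∑[ w < n ] q w
countᵇ-positive e p q p+q≡e =
  trans (countᵇ≡∑ λ w → e w ∧ (0 <ᵇ p w)) (sum-cong-≗ λ w → proj₁ (𝟙-positive (e w) (p w) (q w) (p+q≡e w))) ,
  trans (countᵇ≡∑ λ w → e w ∧ not (0 <ᵇ p w)) (sum-cong-≗ λ w → proj₂ (𝟙-positive (e w) (p w) (q w) (p+q≡e w)))

countᵇ-fromTrueSide : ∀ s (e : Fin n → Bool) (p q : Fin n → ℕ) → (∀ w → p w + q w ≡ 𝟙 (e w)) →
  NearlyEqual (∑[ w < n ] p w) (∑[ w < n ] q w) →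
  NearlyEqual (countᵇ λ w → e w ∧ fromTrueSide s (p w) (q w)) (countᵇ λ w → e w ∧ not (fromTrueSide s (p w) (q w)))
countᵇ-fromTrueSide true  e p q p+q≡e p≈q =
  let count-p , count-q = countᵇ-positive e p q p+q≡e
  in subst₂ NearlyEqual (sym count-p) (sym count-q) p≈q
countᵇ-fromTrueSide false e p q p+q≡e p≈q =
  let count-q , count-p = countᵇ-positive e q p λ w → trans (+-comm (q w) (p w)) (p+q≡e w)
  in subst₂ NearlyEqual (sym count-q) (sym count-p) (swap p≈q)

𝟙-one-side : ∀ e s t → (T e → s ≢ t) → 𝟙 (s ∧ e) + 𝟙 (t ∧ e) ≡ 𝟙 e
𝟙-one-side false s     t     _      = cong₂ _+_ (cong 𝟙 (∧-zeroʳ s)) (cong 𝟙 (∧-zeroʳ t))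
𝟙-one-side true  false true  _      = refl
𝟙-one-side true  true  false _      = refl
𝟙-one-side true  false false s≢t    = ⊥-elim (s≢t _ refl)
𝟙-one-side true  true  true  s≢t    = ⊥-elim (s≢t _ refl)

balancedSplit : (G : SimpleGraph n) → Bipartite G → BalancedSplit G
balancedSplit {n} G (side , proper) = record
  { colour    = a
  ; symmetric = λ u v uv → fromTrueSide-swap (m u v) (m v u) (proper u v uv)
  ; balanced  = λ x → countᵇ-fromTrueSide (side x) (adj G x) (m x) (λ w → m w x) (each-edge-once x)
      (subst₂ NearlyEqual (sym (∑-multiplicity-out x R)) (sym (∑-multiplicity-in x R)) (balanced-R x))
  }
  where
  open ≡-Reasoning
  open Orientation (_≟_ {n})
  L₀ : List (Fin n × Fin n)
  L₀ = pairsWhere λ u v → side u ∧ adj G u v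
  R : List (Fin n × Fin n)
  R = proj₁ (balanced-reorientation L₀)
  L₀↝R : Reorientation L₀ R
  L₀↝R = proj₁ (proj₂ (balanced-reorientation L₀))
  balanced-R : Balanced R
  balanced-R = proj₂ (proj₂ (balanced-reorientation L₀))
  m : Fin n → Fin n → ℕ
  m x w = multiplicity (x , w) R
  a : Fin n → Fin n → Bool
  a u v = fromTrueSide (side u) (m u v) (m v u)
  each-edge-once : ∀ x w → m x w + m w x ≡ 𝟙 (adj G x w)
  each-edge-once x w = begin
    edgeMultiplicity x w R                            ≡⟨ edgeMultiplicity-reorientation x w L₀↝R ⟩
    edgeMultiplicity x w L₀                           ≡⟨ cong₂ _+_ (multiplicity-pairsWhere _ x w) (multiplicity-pairsWhere _ w x) ⟩
    𝟙 (side x ∧ adj G x w) + 𝟙 (side w ∧ adj G w x)  ≡⟨ cong (λ b → 𝟙 (side x ∧ adj G x w) + 𝟙 (side w ∧ b)) (SimpleGraph.sym G w x) ⟩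
    𝟙 (side x ∧ adj G x w) + 𝟙 (side w ∧ adj G x w)  ≡⟨ 𝟙-one-side (adj G x w) (side x) (side w) (proper x w) ⟩
    𝟙 (adj G x w)                                     ∎

half-≤ : ∀ {m n d} → NearlyEqual m n → m + n ≡ d → 2 * m ≤ suc d
half-≤ {m} {n} (m≤1+n , _) refl = begin
  2 * m          ≡⟨ cong (m +_) (+-identityʳ m) ⟩
  m + m          ≤⟨ +-monoʳ-≤ m m≤1+n ⟩
  m + suc n      ≡⟨ +-suc m n ⟩
  suc (m + n)    ∎
  where open ≤-Reasoning

quarter-≤ : ∀ k p {d} → 2 * k ≤ suc p → 2 * p ≤ suc d → 2 * (2 * k) ≤ 3 + d
quarter-≤ k p {d} 2k≤1+p 2p≤1+d = begin
  2 * (2 * k)    ≤⟨ *-monoʳ-≤ 2 2k≤1+p ⟩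
  2 * suc p      ≡⟨ *-suc 2 p ⟩
  2 + 2 * p      ≤⟨ +-monoʳ-≤ 2 2p≤1+d ⟩
  3 + d          ∎
  where open ≤-Reasoning

majority-≤ : ∀ {m d} → 2 * m ≤ 3 + d → 4 ≤ d → m ≤ d ∸ 1
majority-≤ {m} {d} 2m≤3+d 4≤d =
  subst (m ≤_) (pred[m∸n]≡m∸[1+n] d 0) (<⇒≤pred (*-cancelˡ-< 2 m d 2m<2d))
  where
  open ≤-Reasoning
  2m<2d : 2 * m < 2 * d
  2m<2d = begin-strict
    2 * m          ≤⟨ 2m≤3+d ⟩
    3 + d          <⟨ +-monoˡ-≤ d 4≤d ⟩
    d + d          ≡⟨ cong (d +_) (+-identityʳ d) ⟨
    2 * d          ∎

quarter-bound : {G : SimpleGraph n} (s : BalancedSplit G) (t : BalancedSplit (subgraph s)) → ∀ x →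
  2 * (2 * countᵇ (λ w → (adj G x w ∧ colour s x w) ∧ colour t x w)) ≤ 3 + degree G x
quarter-bound {G = G} s t x =
  quarter-≤ (countᵇ λ w → (adj G x w ∧ colour s x w) ∧ colour t x w) (countᵇ λ w → adj G x w ∧ colour s x w)
  (half-≤ (balanced t x) (sym (countᵇ-split (λ w → adj G x w ∧ colour s x w) (colour t x))))
  (half-≤ (balanced s x) (sym (countᵇ-split (adj G x) (colour s x))))

quadrant : Bool → Bool → Bool → Fin 4
quadrant a b c = if a then (if b then 0F else 1F) else (if c then 2F else 3F)

quadrant-cong : ∀ {a a′ b b′ c c′} → a ≡ a′ → (T a → b ≡ b′) → (T (not a) → c ≡ c′) →
  quadrant a b c ≡ quadrant a′ b′ c′
quadrant-cong {true}  refl b≡b′ _    = cong (λ b → if b then 0F else 1F) (b≡b′ _)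
quadrant-cong {false} refl _    c≡c′ = cong (λ c → if c then 2F else 3F) (c≡c′ _)

quadrant-classes : ∀ a b c →
  ⌊ quadrant a b c ≟ 0F ⌋ ≡ a ∧ b × ⌊ quadrant a b c ≟ 1F ⌋ ≡ a ∧ not b ×
  ⌊ quadrant a b c ≟ 2F ⌋ ≡ not a ∧ c × ⌊ quadrant a b c ≟ 3F ⌋ ≡ not a ∧ not c
quadrant-classes true  true  _     = refl , refl , refl , refl
quadrant-classes true  false _     = refl , refl , refl , refl
quadrant-classes false _     true  = refl , refl , refl , refl
quadrant-classes false _     false = refl , refl , refl , refl

balancedFourColouring : (G : SimpleGraph n) → Bipartite G →
  Σ (EdgeColouring G (Fin 4)) λ c →
    ∀ x α → 2 * (2 * countᵇ (λ w → adj G x w ∧ ⌊ proj₁ c x w ≟ α ⌋)) ≤ 3 + degree G x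
balancedFourColouring {n} G bipartite = (c , c-symmetric) , class-bound
  where
  s : BalancedSplit G
  s = balancedSplit G bipartite
  t₀ : BalancedSplit (subgraph s)
  t₀ = balancedSplit (subgraph s) (subgraph-bipartite s bipartite)
  t₁ : BalancedSplit (subgraph (opposite s))
  t₁ = balancedSplit (subgraph (opposite s)) (subgraph-bipartite (opposite s) bipartite)
  c : Fin n → Fin n → Fin 4
  c u v = quadrant (colour s u v) (colour t₀ u v) (colour t₁ u v)
  c-symmetric : ∀ u v → T (adj G u v) → c u v ≡ c v u
  c-symmetric u v uv = quadrant-cong (symmetric s u v uv)
    (λ su → symmetric t₀ u v (Equivalence.from T-∧ (uv , su)))
    (λ ¬su → symmetric t₁ u v (Equivalence.from T-∧ (uv , ¬su)))
  class-via : ∀ x α (s′ : BalancedSplit G) (t′ : BalancedSplit (subgraph s′)) →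
    (∀ w → ⌊ c x w ≟ α ⌋ ≡ colour s′ x w ∧ colour t′ x w) →
    2 * (2 * countᵇ (λ w → adj G x w ∧ ⌊ c x w ≟ α ⌋)) ≤ 3 + degree G x
  class-via x α s′ t′ class≡ = subst (λ k → 2 * (2 * k) ≤ 3 + degree G x)
    (countᵇ-cong λ w → trans (∧-assoc (adj G x w) _ _) (cong (adj G x w ∧_) (sym (class≡ w))))
    (quarter-bound s′ t′ x)
  class-bound : ∀ x α → 2 * (2 * countᵇ (λ w → adj G x w ∧ ⌊ c x w ≟ α ⌋)) ≤ 3 + degree G x
  class-bound x 0F = class-via x 0F s t₀ λ w →
    proj₁ (quadrant-classes (colour s x w) (colour t₀ x w) (colour t₁ x w))
  class-bound x 1F = class-via x 1F s (opposite t₀) λ w →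
    proj₁ (proj₂ (quadrant-classes (colour s x w) (colour t₀ x w) (colour t₁ x w)))
  class-bound x 2F = class-via x 2F (opposite s) t₁ λ w →
    proj₁ (proj₂ (proj₂ (quadrant-classes (colour s x w) (colour t₀ x w) (colour t₁ x w))))
  class-bound x 3F = class-via x 3F (opposite s) (opposite t₁) λ w →
    proj₂ (proj₂ (proj₂ (quadrant-classes (colour s x w) (colour t₀ x w) (colour t₁ x w))))

∧-drop-middle : ∀ a b c → T (a ∧ b ∧ c) → T (a ∧ c)
∧-drop-middle true true _ a∧b∧c = a∧b∧c

strongMajority-fromVertexBound : ∀ {k} {G : SimpleGraph n} (c : Fin n → Fin n → Fin k) →
  (∀ x α → 2 * countᵇ (λ w → adj G x w ∧ ⌊ c x w ≟ α ⌋) ≤ degree G x ∸ 1) → IsStrongMajority G c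
strongMajority-fromVertexBound {G = G} c bound u v _ α =
  subst (_≤ (degree G u ∸ 1) + (degree G v ∸ 1)) (sym (*-distribˡ-+ 2 (colouredAt G c u v α) _))
    (+-mono-≤ (at u v) (at v u))
  where
  at : ∀ x y → 2 * colouredAt G c x y α ≤ degree G x ∸ 1
  at x y = ≤-trans (*-monoʳ-≤ 2 (countᵇ-mono λ w → ∧-drop-middle (adj G x w) _ _)) (bound x α)

proposition3 : (n : ℕ) (G : SimpleGraph n) → Bipartite G → MinDegreeAtLeast G 4 →
    MajIndexAtMost G 4
proposition3 n G bipartite δ≥4 =
  let c , quarter = balancedFourColouring G bipartite
  in c , strongMajority-fromVertexBound {G = G} (proj₁ c) λ x α → majority-≤ (quarter x α) (δ≥4 x)
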